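{- Let $m$ be an odd positive integer and $n$ a positive integer divisible by $4$. Then the checkerboard graph $R_{m,n}$ admits no graph derangement of cycle type $(4,4,\dots,4)$, and therefore $R_{m,n}$ is not even universal.
   Context: For positive integers $m,n$, the checkerboard graph $R_{m,n}$ has vertex set $\{1,\dots,m\}\times\{1,\dots,n\}$, with $(x_1,x_2)$ adjacent to $(y_1,y_2)$ iff $|x_1-y_1|+|x_2-y_2|=1$. A graph derangement of a graph $G=(V,E)$ is an injective map $f:V\to V$ with $f(v)$ adjacent to $v$ for all $v$. For a finite graph, the cycles of $f$ are its orbits, and the cycle type of $f$ is the partition of $\#V$ given by the multiset of cycle sizes; $(4,4,\dots,4)$ denotes the partition of $mn$ into parts all equal to $4$. A finite graph with $N$ vertices is even universal if every partition of $N$ into even parts is the cycle type of some graph derangement of it. -}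

module Defs where

open import Data.Nat using (ℕ; zero; suc; _+_; _*_; _<_; _∸_)
open import Data.Nat.Properties using ()
open import Data.Fin using (Fin; toℕ)
open import Data.List using (List; length; lookup)
open import Data.Nat.ListAction using (sum)
open import Data.List.Relation.Unary.All using (All)
open import Data.Product using (_×_; _,_; Σ; ∃; ∃-syntax)
open import Data.Nat.Divisibility using (_∣_)
open import Relation.Binary.PropositionalEquality using (_≡_; _≢_)
open import Relation.Nullary using (¬_)
open import Function.Definitions using (Injective)

dist : ℕ → ℕ → ℕ
dist a b = (a ∸ b) + (b ∸ a)

-- Checkerboard graph R_{m,n}: vertices {1..m}×{1..n}, encoded 0-indexed as Fin m × Fin n
-- (a shift of coordinates does not change |x₁-y₁|+|x₂-y₂|).
RVertex : ℕ → ℕ → Set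
RVertex m n = Fin m × Fin n

RAdj : ∀ {m n} → RVertex m n → RVertex m n → Set
RAdj (x₁ , x₂) (y₁ , y₂) = dist (toℕ x₁) (toℕ y₁) + dist (toℕ x₂) (toℕ y₂) ≡ 1

iter : ∀ {V : Set} → (V → V) → ℕ → V → V
iter f zero v = v
iter f (suc k) v = f (iter f k v)

IsGraphDerangement : {V : Set} → (V → V → Set) → (V → V) → Set
IsGraphDerangement {V} Adj f = Injective _≡_ _≡_ f × (∀ (v : V) → Adj v (f v))

CycleSize : {V : Set} → (V → V) → V → ℕ → Set
CycleSize f v k = (0 < k) × (iter f k v ≡ v) × (∀ j → 0 < j → j < k → iter f j v ≢ v)

SameOrbit : {V : Set} → (V → V) → V → V → Set
SameOrbit f u v = ∃[ k ] iter f k u ≡ v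

-- f has cycle type λ (a partition given as a list of its parts, in any order):
-- there is one representative per part, representatives lie in pairwise distinct orbits,
-- every vertex lies in the orbit of some representative, and the orbit of the
-- representative of part i has size λ_i.
HasCycleType : {V : Set} → (V → V) → List ℕ → Set
HasCycleType {V} f λs =
  Σ (Fin (length λs) → V) λ rep →
      (∀ i → CycleSize f (rep i) (lookup λs i))
    × (∀ i j → SameOrbit f (rep i) (rep j) → i ≡ j)
    × (∀ v → ∃[ i ] SameOrbit f (rep i) v)

IsEvenPartition : ℕ → List ℕ → Set
IsEvenPartition N λs = All (λ p → (0 < p) × (2 ∣ p)) λs × (sum λs ≡ N)

EvenUniversal : {V : Set} → (V → V → Set) → ℕ → Set
EvenUniversal {V} Adj N =
  ∀ λs → IsEvenPartition N λs → Σ (V → V) λ f → IsGraphDerangement Adj f × HasCycleType f λs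

-- A derangement all of whose cycles have length 4 runs each cycle around a
-- unit square of the grid, so along every cycle vertical and horizontal steps
-- alternate.  Sending each vertex to its vertical neighbour on its square is
-- then a fixed-point-free involution that preserves columns; restricted to
-- one column it pairs off the m rows, so m is even.
module Submission where

open import Defs
open import Data.Nat using (ℕ; _*_; _<_; _/_)
open import Data.Nat.Divisibility using (_∣_)
open import Data.List using (replicate)
open import Data.Product using (_×_; Σ)
open import Relation.Nullary using (¬_)

open import Data.Nat as ℕ using (zero; suc; z<s; s<s; NonZero; >-nonZero⁻¹)
import Data.Nat.Properties as ℕ
open import Data.Nat.Divisibility using (divides; ∣-trans; n∣m*n)
open import Data.Nat.DivMod using (m/n*n≡m)
open import Data.Nat.ListAction using (sum)
open import Data.Integer as ℤ using (ℤ; +_; 0ℤ; 1ℤ; _◃_; _+_)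
import Data.Integer.Properties as ℤ
open import Data.Sign as Sign using (Sign)
open import Data.Fin using (Fin; toℕ)
import Data.Fin.Properties as Fin
open import Data.Fin.Permutation using (permutation)
open import Data.List using (List; []; _∷_; foldr; lookup)
import Data.List.Relation.Unary.All.Properties as All
open import Data.Product using (_,_; proj₁; proj₂; ∃)
open import Data.Sum using (_⊎_; inj₁; inj₂)
open import Data.Empty using (⊥-elim)
open import Function using (_∘_)
open import Function.Definitions using (Injective)
open import Relation.Nullary using (Dec; yes; no)
open import Relation.Nullary.Decidable using (map′; _×-dec_; _→-dec_; ¬?; toWitness)
open import Relation.Binary.Definitions using (DecidableEquality)
open import Relation.Binary.PropositionalEquality
open import Algebra.Bundles using (AbelianGroup)
open import Algebra.Properties.Group (AbelianGroup.group ℤ.+-0-abelianGroup) using (∙-cancelˡ)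
open import Algebra.Properties.CommutativeMonoid.Sum ℕ.+-0-commutativeMonoid as ∑
  using (sum-permute; ∑-distrib-+; sum-cong-≗)

open ≡-Reasoning

data Axis : Set where
  vertical horizontal : Axis

perpendicular : Axis → Axis
perpendicular vertical   = horizontal
perpendicular horizontal = vertical

perpendicular-involutive : ∀ x → perpendicular (perpendicular x) ≡ x
perpendicular-involutive vertical   = refl
perpendicular-involutive horizontal = refl

_≟-axis_ : DecidableEquality Axis
vertical   ≟-axis vertical   = yes refl
vertical   ≟-axis horizontal = no λ ()
horizontal ≟-axis vertical   = no λ ()
horizontal ≟-axis horizontal = yes refl

∀-axis? : {P : Axis → Set} → (∀ x → Dec (P x)) → Dec (∀ x → P x)
∀-axis? P? = map′ (λ (p , q) → λ { vertical → p ; horizontal → q })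
                  (λ h → h vertical , h horizontal)
                  (P? vertical ×-dec P? horizontal)

∀-sign? : {P : Sign → Set} → (∀ s → Dec (P s)) → Dec (∀ s → P s)
∀-sign? P? = map′ (λ (p , q) → λ { Sign.+ → p ; Sign.- → q })
                  (λ h → h Sign.+ , h Sign.-)
                  (P? Sign.+ ×-dec P? Sign.-)

Dir : Set
Dir = Axis × Sign

∀-dir? : {P : Dir → Set} → (∀ d → Dec (P d)) → Dec (∀ d → P d)
∀-dir? P? = map′ (λ h (x , s) → h x s) (λ h x s → h (x , s))
                 (∀-axis? λ x → ∀-sign? λ s → P? (x , s))

Δ : Axis → Dir → ℤ
Δ vertical   (vertical   , s) = s ◃ 1
Δ horizontal (horizontal , s) = s ◃ 1
Δ _          _                = 0ℤ

Δ* : Axis → List Dir → ℤ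
Δ* x = foldr (λ d r → Δ x d + r) 0ℤ

Closed : List Dir → Set
Closed ds = ∀ x → Δ* x ds ≡ 0ℤ

closed? : ∀ ds → Dec (Closed ds)
closed? ds = ∀-axis? λ x → Δ* x ds ℤ.≟ 0ℤ

-- If a and b are parallel and b does not undo a, then b = a; closing the
-- square then forces c = d = −a, so d undoes a.  Checked over all 4⁴ cases.
square-alternates : ∀ a b c d → Closed (a ∷ b ∷ c ∷ d ∷ []) →
  ¬ Closed (a ∷ b ∷ []) → ¬ Closed (d ∷ a ∷ []) → proj₁ b ≡ perpendicular (proj₁ a)
square-alternates = toWitness {a? = ∀-dir? λ a → ∀-dir? λ b → ∀-dir? λ c → ∀-dir? λ d →
    closed? (a ∷ b ∷ c ∷ d ∷ []) →-dec ¬? (closed? (a ∷ b ∷ [])) →-dec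
    ¬? (closed? (d ∷ a ∷ [])) →-dec (proj₁ b ≟-axis perpendicular (proj₁ a))} _

dist≡0⇒≡ : ∀ a b → dist a b ≡ 0 → a ≡ b
dist≡0⇒≡ zero    zero    _ = refl
dist≡0⇒≡ (suc a) (suc b) e = cong suc (dist≡0⇒≡ a b e)

dist≡1⇒unitStep : ∀ a b → dist a b ≡ 1 → ∃ λ s → + b ≡ + a + (s ◃ 1)
dist≡1⇒unitStep zero       (suc zero) _ = Sign.+ , refl
dist≡1⇒unitStep (suc zero) zero       _ = Sign.- , refl
dist≡1⇒unitStep (suc a) (suc b) e with dist≡1⇒unitStep a b e
... | s , b≡a+s = s , (begin
  1ℤ + + b              ≡⟨ cong (λ z → 1ℤ + z) b≡a+s ⟩
  1ℤ + (+ a + (s ◃ 1))  ≡⟨ ℤ.+-assoc 1ℤ (+ a) (s ◃ 1) ⟨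
  + suc a + (s ◃ 1)     ∎)

≡⇒zeroStep : ∀ {a b} → a ≡ b → + b ≡ + a + 0ℤ
≡⇒zeroStep {a} refl = sym (ℤ.+-identityʳ (+ a))

m+n≡1⇒ : ∀ a b → a ℕ.+ b ≡ 1 → (a ≡ 0 × b ≡ 1) ⊎ (a ≡ 1 × b ≡ 0)
m+n≡1⇒ zero       b    e = inj₁ (refl , e)
m+n≡1⇒ (suc zero) zero _ = inj₂ (refl , refl)

module _ {m n : ℕ} where

  coord : Axis → RVertex m n → ℕ
  coord vertical   (i , _) = toℕ i
  coord horizontal (_ , j) = toℕ j

  coord-injective : ∀ {u v} → (∀ x → coord x u ≡ coord x v) → u ≡ v
  coord-injective e = cong₂ _,_ (Fin.toℕ-injective (e vertical)) (Fin.toℕ-injective (e horizontal))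

  record Step (u : RVertex m n) (d : Dir) (v : RVertex m n) : Set where
    constructor mkStep
    field offset : ∀ x → + coord x v ≡ + coord x u + Δ x d
  open Step

  infixr 5 _◅_
  data Walk : RVertex m n → List Dir → RVertex m n → Set where
    []  : ∀ {u} → Walk u [] u
    _◅_ : ∀ {u d v ds w} → Step u d v → Walk v ds w → Walk u (d ∷ ds) w

  walk-offset : ∀ {u ds v} → Walk u ds v → ∀ x → + coord x v ≡ + coord x u + Δ* x ds
  walk-offset {u} [] x = sym (ℤ.+-identityʳ (+ coord x u))
  walk-offset {u} {d ∷ ds} {w} (_◅_ {v = v} s walk) x = begin
    + coord x w                      ≡⟨ walk-offset walk x ⟩
    + coord x v + Δ* x ds            ≡⟨ cong (_+ Δ* x ds) (offset s x) ⟩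
    (+ coord x u + Δ x d) + Δ* x ds  ≡⟨ ℤ.+-assoc (+ coord x u) (Δ x d) (Δ* x ds) ⟩
    + coord x u + Δ* x (d ∷ ds)      ∎

  walk-closed : ∀ {u ds} → Walk u ds u → Closed ds
  walk-closed {u} {ds} walk x =
    ∙-cancelˡ (+ coord x u) (Δ* x ds) 0ℤ (trans (sym (walk-offset walk x)) (sym (ℤ.+-identityʳ _)))

  closed-walk-returns : ∀ {u ds v} → Walk u ds v → Closed ds → u ≡ v
  closed-walk-returns {u} {ds} {v} walk closed = coord-injective λ x → ℤ.+-injective (begin
    + coord x u              ≡⟨ ℤ.+-identityʳ (+ coord x u) ⟨
    + coord x u + 0ℤ         ≡⟨ cong (λ z → + coord x u + z) (closed x) ⟨
    + coord x u + Δ* x ds    ≡⟨ walk-offset walk x ⟨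
    + coord x v              ∎)

  adjacent⇒step : ∀ {u v} → RAdj u v → ∃ λ d → Step u d v
  adjacent⇒step {i , j} {i′ , j′} adj
    with m+n≡1⇒ (dist (toℕ i) (toℕ i′)) (dist (toℕ j) (toℕ j′)) adj
  ... | inj₁ (rows , cols) with dist≡1⇒unitStep (toℕ j) (toℕ j′) cols
  ...   | s , step = (horizontal , s) , mkStep λ where
          vertical   → ≡⇒zeroStep (dist≡0⇒≡ _ _ rows)
          horizontal → step
  adjacent⇒step {i , j} {i′ , j′} adj
      | inj₂ (rows , cols) with dist≡1⇒unitStep (toℕ i) (toℕ i′) rows
  ...   | s , step = (vertical , s) , mkStep λ where
          vertical   → step
          horizontal → ≡⇒zeroStep (dist≡0⇒≡ _ _ cols)

  vertical-step-keeps-column : ∀ {u d v} → Step u d v → proj₁ d ≡ vertical → proj₂ v ≡ proj₂ u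
  vertical-step-keeps-column {u} step refl =
    Fin.toℕ-injective (ℤ.+-injective (trans (offset step horizontal) (ℤ.+-identityʳ (+ coord horizontal u))))

module SquareCycles {m n : ℕ} (f : RVertex m n → RVertex m n)
  (adjacent : ∀ v → RAdj v (f v))
  (f⁴≡id : ∀ v → f (f (f (f v))) ≡ v)
  (f²≢id : ∀ v → f (f v) ≢ v) where

  dir : RVertex m n → Dir
  dir v = proj₁ (adjacent⇒step {u = v} {v = f v} (adjacent v))

  step : ∀ v → Step v (dir v) (f v)
  step v = proj₂ (adjacent⇒step {u = v} {v = f v} (adjacent v))

  stepAxis : RVertex m n → Axis
  stepAxis v = proj₁ (dir v)

  stepAxis-alternates : ∀ v → stepAxis (f v) ≡ perpendicular (stepAxis v)
  stepAxis-alternates v = square-alternates (dir v) (dir (f v)) (dir (f (f v))) (dir v₃)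
    (walk-closed (step v ◅ step (f v) ◅ step (f (f v)) ◅ step₃ ◅ []))
    (f²≢id v ∘ sym ∘ closed-walk-returns (step v ◅ step (f v) ◅ []))
    (f²≢id (f v) ∘ closed-walk-returns (step₃ ◅ step v ◅ []))
    where
    v₃ : RVertex m n
    v₃ = f (f (f v))
    step₃ : Step v₃ (dir v₃) v
    step₃ = subst (Step v₃ (dir v₃)) (f⁴≡id v) (step v₃)

  stepAxis-f³ : ∀ v → stepAxis (f (f (f v))) ≡ perpendicular (stepAxis v)
  stepAxis-f³ v = begin
    stepAxis (f (f (f v)))                          ≡⟨ stepAxis-alternates (f (f v)) ⟩
    perpendicular (stepAxis (f (f v)))              ≡⟨ cong perpendicular (stepAxis-alternates (f v)) ⟩
    perpendicular (perpendicular (stepAxis (f v)))  ≡⟨ perpendicular-involutive (stepAxis (f v)) ⟩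
    stepAxis (f v)                                  ≡⟨ stepAxis-alternates v ⟩
    perpendicular (stepAxis v)                      ∎

  -- The other endpoint of the vertical edge of v's square.
  partner : RVertex m n → RVertex m n
  partner v with stepAxis v
  ... | vertical   = f v
  ... | horizontal = f (f (f v))

  partner-vertical : ∀ v → stepAxis v ≡ vertical → partner v ≡ f v
  partner-vertical v e rewrite e = refl

  partner-horizontal : ∀ v → stepAxis v ≡ horizontal → partner v ≡ f (f (f v))
  partner-horizontal v e rewrite e = refl

  f≢id : ∀ v → f v ≢ v
  f≢id v fv≡v = f²≢id v (trans (cong f fv≡v) fv≡v)

  partner-involutive : ∀ v → partner (partner v) ≡ v
  partner-involutive v with stepAxis v in e
  ... | vertical   = trans (partner-horizontal (f v) (trans (stepAxis-alternates v) (cong perpendicular e)))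
                           (f⁴≡id v)
  ... | horizontal = trans (partner-vertical (f (f (f v))) (trans (stepAxis-f³ v) (cong perpendicular e)))
                           (f⁴≡id v)

  partner-keeps-column : ∀ v → proj₂ (partner v) ≡ proj₂ v
  partner-keeps-column v with stepAxis v in e
  ... | vertical   = vertical-step-keeps-column (step v) e
  ... | horizontal = begin
    proj₂ (f (f (f v)))          ≡⟨ vertical-step-keeps-column (step (f (f (f v))))
                                      (trans (stepAxis-f³ v) (cong perpendicular e)) ⟨
    proj₂ (f (f (f (f v))))      ≡⟨ cong proj₂ (f⁴≡id v) ⟩
    proj₂ v                      ∎

  partner-≢ : ∀ v → partner v ≢ v
  partner-≢ v with stepAxis v
  ... | vertical   = f≢id v
  ... | horizontal = λ f³v≡v → f≢id v (trans (cong f (sym f³v≡v)) (f⁴≡id v))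

∑-const-1 : ∀ k → ∑.sum {k} (λ _ → 1) ≡ k
∑-const-1 zero    = refl
∑-const-1 (suc k) = cong suc (∑-const-1 k)

-- Each pair {i, g i} contributes exactly one to  ∑ᵢ [i < g i],  so m is twice that sum.
fixedPointFreeInvolution⇒even : ∀ {m} (g : Fin m → Fin m) →
  (∀ i → g (g i) ≡ i) → (∀ i → g i ≢ i) → 2 ∣ m
fixedPointFreeInvolution⇒even {m} g involutive fixedPointFree = divides (∑.sum ascends) (begin
  m                                          ≡⟨ ∑-const-1 m ⟨
  ∑.sum {m} (λ _ → 1)                        ≡⟨ sum-cong-≗ one-per-pair ⟩
  ∑.sum (λ i → ascends i ℕ.+ ascends (g i))  ≡⟨ ∑-distrib-+ ascends (ascends ∘ g) ⟩
  ∑.sum ascends ℕ.+ ∑.sum (ascends ∘ g)      ≡⟨ cong (∑.sum ascends ℕ.+_) (sum-permute ascends (permutation g g involutive involutive)) ⟨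
  ∑.sum ascends ℕ.+ ∑.sum ascends            ≡⟨ cong (∑.sum ascends ℕ.+_) (ℕ.+-identityʳ _) ⟨
  2 * ∑.sum ascends                          ≡⟨ ℕ.*-comm 2 (∑.sum ascends) ⟩
  ∑.sum ascends * 2                          ∎)
  where
  below : Fin m → Fin m → ℕ
  below i j with toℕ i ℕ.<? toℕ j
  ... | yes _ = 1
  ... | no  _ = 0

  ascends : Fin m → ℕ
  ascends i = below i (g i)

  below-total : ∀ i j → i ≢ j → below i j ℕ.+ below j i ≡ 1
  below-total i j i≢j with toℕ i ℕ.<? toℕ j | toℕ j ℕ.<? toℕ i
  ... | yes i<j | yes j<i = ⊥-elim (ℕ.<-asym i<j j<i)
  ... | yes _   | no  _   = refl
  ... | no  _   | yes _   = refl
  ... | no  i≮j | no  j≮i = ⊥-elim (i≢j (Fin.toℕ-injective (ℕ.≤-antisym (ℕ.≮⇒≥ j≮i) (ℕ.≮⇒≥ i≮j))))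

  one-per-pair : ∀ i → 1 ≡ ascends i ℕ.+ ascends (g i)
  one-per-pair i = begin
    1                                ≡⟨ below-total i (g i) (fixedPointFree i ∘ sym) ⟨
    below i (g i) ℕ.+ below (g i) i  ≡⟨ cong (λ j → below i (g i) ℕ.+ below (g i) j) (involutive i) ⟨
    ascends i ℕ.+ ascends (g i)      ∎

iter-shift : ∀ {V : Set} (f : V → V) a x → iter f a (f x) ≡ f (iter f a x)
iter-shift f zero    x = refl
iter-shift f (suc a) x = cong f (iter-shift f a x)

iter-comm : ∀ {V : Set} (f : V → V) a b x → iter f a (iter f b x) ≡ iter f b (iter f a x)
iter-comm f a zero    x = refl
iter-comm f a (suc b) x = begin
  iter f a (f (iter f b x))  ≡⟨ iter-shift f a (iter f b x) ⟩
  f (iter f a (iter f b x))  ≡⟨ cong f (iter-comm f a b x) ⟩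
  f (iter f b (iter f a x))  ∎

iter-injective : ∀ {V : Set} {f : V → V} → Injective _≡_ _≡_ f → ∀ k → Injective _≡_ _≡_ (iter f k)
iter-injective f-inj zero    e = e
iter-injective f-inj (suc k) e = iter-injective f-inj k (f-inj e)

lookup-replicate : ∀ k (p : ℕ) i → lookup (replicate k p) i ≡ p
lookup-replicate (suc k) p Fin.zero    = refl
lookup-replicate (suc k) p (Fin.suc i) = lookup-replicate k p i

-- Cycle sizes are orbit invariants; the minimality half needs f injective.
uniformCycleType⇒cycleSize : ∀ {V : Set} {f : V → V} {k p} → Injective _≡_ _≡_ f →
  HasCycleType f (replicate k p) → ∀ v → CycleSize f v p
uniformCycleType⇒cycleSize {f = f} {k} {p} f-inj (rep , size , _ , covered) v
  with covered v
... | i , j , refl with subst (CycleSize f (rep i)) (lookup-replicate k p i) (size i)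
... | p>0 , returns , minimal =
  p>0 , trans (iter-comm f p j (rep i)) (cong (iter f j) returns) ,
  λ l l>0 l<p returns′ → minimal l l>0 l<p
    (iter-injective f-inj j (trans (sym (iter-comm f l j (rep i))) returns′))

squareCycles⇒evenRows : ∀ {m n} → 0 < n → (f : RVertex m n → RVertex m n) →
  (∀ v → RAdj v (f v)) → (∀ v → CycleSize f v 4) → 2 ∣ m
squareCycles⇒evenRows {m} {suc _} _ f adjacent size =
  fixedPointFreeInvolution⇒even rowPartner
    (λ i → cong proj₁ (trans (cong partner (sym (onColumn₀ i))) (partner-involutive (i , Fin.zero))))
    (λ i rowPartner-i≡i → partner-≢ (i , Fin.zero) (trans (onColumn₀ i) (cong (_, Fin.zero) rowPartner-i≡i)))
  where
  open SquareCycles f adjacent (λ v → proj₁ (proj₂ (size v)))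
                               (λ v → proj₂ (proj₂ (size v)) 2 z<s (s<s (s<s z<s)))

  rowPartner : Fin m → Fin m
  rowPartner i = proj₁ (partner (i , Fin.zero))

  onColumn₀ : ∀ i → partner (i , Fin.zero) ≡ (rowPartner i , Fin.zero)
  onColumn₀ i = cong (rowPartner i ,_) (partner-keeps-column (i , Fin.zero))

noSquareCycleType : ∀ {m n} → ¬ (2 ∣ m) → 0 < n → ∀ k →
  ¬ (Σ (RVertex m n → RVertex m n) λ f →
       IsGraphDerangement (RAdj {m} {n}) f × HasCycleType f (replicate k 4))
noSquareCycleType m-odd n>0 k (f , (f-injective , adjacent) , cycleType) =
  m-odd (squareCycles⇒evenRows n>0 f adjacent (uniformCycleType⇒cycleSize {k = k} f-injective cycleType))

sum-replicate : ∀ k p → sum (replicate k p) ≡ k * p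
sum-replicate zero    p = refl
sum-replicate (suc k) p = cong (p ℕ.+_) (sum-replicate k p)

replicate-isEvenPartition : ∀ {N p} .{{_ : NonZero p}} → 2 ∣ p → p ∣ N →
  IsEvenPartition N (replicate (N / p) p)
replicate-isEvenPartition {N} {p} 2∣p p∣N =
  All.replicate⁺ (N / p) (>-nonZero⁻¹ p , 2∣p) , trans (sum-replicate (N / p) p) (m/n*n≡m p∣N)

proposition19 : (m n : ℕ) → 0 < m → ¬ (2 ∣ m) → 0 < n → 4 ∣ n →
    (¬ (Σ (RVertex m n → RVertex m n) λ f →
          IsGraphDerangement (RAdj {m} {n}) f × HasCycleType f (replicate ((m * n) / 4) 4)))
    × (¬ EvenUniversal (RAdj {m} {n}) (m * n))
proposition19 m n _ m-odd n>0 4∣n =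
  noSquareCycleType m-odd n>0 ((m * n) / 4) ,
  λ evenUniversal → noSquareCycleType m-odd n>0 ((m * n) / 4)
    (evenUniversal _ (replicate-isEvenPartition (divides 2 refl) (∣-trans 4∣n (n∣m*n m))))
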